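{- Let $T$ be a perfect tract, $[\varphi:E^r\to T]$ a $T$-matroid with underlying matroid $M$, $F$ a flat of $M$, and $\eta:\mathcal H\to T^E$ a $T$-representation of $M$ corresponding to $[\varphi]$. Then the restriction $\eta_F:\mathcal H_F\to T^E$ of $\eta$ to $\mathcal H_F=\{H\in\mathcal H: F\subseteq H\}$ is a $T$-representation (of the matroid $(M/F)\oplus U_{0,F}$) corresponding to the $F$-quotient $[\varphi_F]$.
   Context: A tract is a commutative monoid $(T,\cdot)$ with an element $0$ such that $0\cdot a=0$ for all $a$ and $T^\times=T\setminus\{0\}$ is an abelian group, together with $N_T\subseteq \mathbb N[T^\times]$ (elements of $T$ regarded in $\mathbb N[T^\times]$, $0$ as zero) containing $0$, closed under addition and multiplication by $\mathbb N[T^\times]$, such that each $a\in T$ has a unique $b\in T$ with $a+b\in N_T$. For $X\in T^E$, $\underline X=\{e:X(e)\neq0\}$. $X\perp Y$ means $\sum_eX(e)Y(e)\in N_T$. $X_1,\dots,X_k$ are linearly dependent if $\sum_jc_jX_j(e)\in N_T$ for all $e$ for some $c_j\in T$ not all $0$. A Grassmann–Plücker (GP) function of rank $r$ on finite $E$ is $\varphi:E^r\to T$ with (GP1) the set $\mathcal B_\varphi$ of $r$-sets $\{e_1,\dots,e_r\}$ with $\varphi(e_1,\dots,e_r)\ne0$ nonempty and the basis set of a matroid; (GP2) $\varphi$ alternating; (GP3) $\varphi(\underline e,a,b)\varphi(\underline e,c,d)-\varphi(\underline e,a,c)\varphi(\underline e,b,d)+\varphi(\underline e,a,d)\varphi(\underline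 e,b,c)\in N_T$ for all $\underline e\in E^{r-2}$, $a,b,c,d\in E$. A $T$-matroid is a class $[\varphi]$ modulo $T^\times$; $M_\varphi$ is the matroid with bases $\mathcal B_\varphi$. Vector set: $\mathcal V_\varphi=\{X:\sum_eX(e)\varphi(i_1,..,i_{r-1},e)\in N_T\ \forall i_j\in E\}$. Dual: with a total order on $E$, $n=|E|$, $\varphi^*(d_1,\dots,d_{n-r})=\mathrm{sign}(d_1,\dots,d_{n-r},e_1,\dots,e_r)\varphi(e_1,\dots,e_r)$ when $E=\{d_1,..,d_{n-r},e_1,..,e_r\}$ (sign of the permutation sorting the sequence), and $0$ if the $d_i$ repeat; covector set $\mathcal V^*_\varphi=\mathcal V_{\varphi^*}$. $T$ is perfect if $X\perp Y$ for all $X\in\mathcal V_\varphi$, $Y\in\mathcal V^*_\varphi$, for every $T$-matroid $[\varphi]$. For a matroid $M$ of rank $r$ on $E$ with hyperplane set $\mathcal H$ and closure $\langle\cdot\rangle$: a hyperplane function for $H$ is $\eta_H:E\to T$ with support $E\setminus H$; a $T$-representation of $M$ is $\eta:\mathcal H\to T^E$ with each $\eta_H$ a hyperplane function for $H$ and $\eta_{H_1},\eta_{H_2},\eta_{H_3}$ linearly dependent whenever $H_1,H_2,H_3$ are pairwise distinct hyperplanes with corank-2 intersection. $\eta$ corresponds to $[\varphi]$ (with $M_\varphi=M$) if $\eta_H(d)/\eta_H(e)=\varphi(i_1,\dots,i_{r-1},d)/\varphi(i_1,\dots,i_{r-1},e)$ for all $H$, all $i_1,..,i_{r-1}\in H$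 spanning $H$, and all $d,e\in E\setminus H$ (such $[\varphi]$ exists uniquely). $F$-quotient: for a flat $F$ of $M=M_\varphi$ of corank $s$ and a basis $\{i_1,\dots,i_{r-s}\}$ of $F$, $\varphi_F:E^s\to T$, $\varphi_F(e_1,\dots,e_s)=\varphi(i_1,\dots,i_{r-s},e_1,\dots,e_s)$ is a GP function whose class $[\varphi_F]$ depends only on $F$; its underlying matroid is $(M/F)\oplus U_{0,F}$ (the elements of $F$ being loops), whose hyperplanes are exactly $\mathcal H_F$. -}

module Defs where

open import Data.Nat using (ℕ; zero; suc; _+_)
open import Data.Bool using (Bool; true; false; if_then_else_; _∧_; not)
open import Data.Fin using (Fin; toℕ; _≟_)
open import Data.Fin.Subset using (Subset; _∈_; _∉_; _⊆_; _∪_; _∩_; _-_; ⁅_⁆; ∣_∣) renaming (⊥ to ∅; ⊤ to full)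
open import Data.List as L using (List; []; _∷_; _++_; map; concatMap; filter; length)
open import Data.List.Relation.Binary.Permutation.Propositional using (_↭_)
open import Data.Vec as V using (Vec; lookup; _[_]≔_; _∷ʳ_; toList; fromList)
open import Data.Product using (Σ; _×_; _,_; ∃)
open import Data.Unit using (⊤)
open import Relation.Nullary using (¬_; yes; no; ⌊_⌋)
open import Relation.Nullary.Decidable using (¬?)
open import Relation.Binary.PropositionalEquality using (_≡_; _≢_; subst)
import Data.Nat as N
import Data.Bool as B

_iff_ : Set → Set → Set
A iff B = (A → B) × (B → A)

-- Elements of ℕ[T^×] are represented by finite lists of
-- elements of T (formal sums), taken up to permutation and up to
-- inserting/removing the element 0 (which is regarded as the zero sum).

record Tract : Set₁ where
  infixl 7 _·_
  field
    Carrier : Set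
    _·_     : Carrier → Carrier → Carrier
    𝟙 𝟘     : Carrier
    ·-assoc : ∀ a b c → (a · b) · c ≡ a · (b · c)
    ·-comm  : ∀ a b → a · b ≡ b · a
    ·-idˡ   : ∀ a → 𝟙 · a ≡ a
    𝟘-absorb : ∀ a → 𝟘 · a ≡ 𝟘
    𝟙≢𝟘     : 𝟙 ≢ 𝟘
    ·-nonzero : ∀ a b → a ≢ 𝟘 → b ≢ 𝟘 → a · b ≢ 𝟘
    inv     : Carrier → Carrier
    inv-r   : ∀ a → a ≢ 𝟘 → a · inv a ≡ 𝟙
    N       : List Carrier → Set
    N-perm  : ∀ {xs ys} → xs ↭ ys → N xs → N ys
    N-𝟘⁺    : ∀ xs → N xs → N (𝟘 ∷ xs)
    N-𝟘⁻    : ∀ xs → N (𝟘 ∷ xs) → N xs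
    N-[]    : N []
    N-+     : ∀ xs ys → N xs → N ys → N (xs ++ ys)
    N-mul   : ∀ xs ys → N xs → N (concatMap (λ y → map (y ·_) xs) ys)
    neg     : Carrier → Carrier
    neg-N   : ∀ a → N (a ∷ neg a ∷ [])
    neg-unique : ∀ a b → N (a ∷ b ∷ []) → b ≡ neg a

module _ {n : ℕ} where

  vset : ∀ {k} → Vec (Fin n) k → Subset n
  vset V.[] = ∅
  vset (x V.∷ v) = ⁅ x ⁆ ∪ vset v

  IsMatroid : (Subset n → Set) → Set
  IsMatroid B =
    (Σ (Subset n) B) ×
    (∀ B₁ B₂ → B B₁ → B B₂ → ∀ x → x ∈ B₁ → x ∉ B₂ →
      Σ (Fin n) λ y → y ∈ B₂ × y ∉ B₁ × B ((B₁ - x) ∪ ⁅ y ⁆))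

  module _ (B : Subset n → Set) where

    Indep : Subset n → Set
    Indep I = Σ (Subset n) λ C → B C × I ⊆ C

    IsBasisOf : Subset n → Subset n → Set
    IsBasisOf A I = I ⊆ A × Indep I × (∀ x → x ∈ A → x ∉ I → ¬ Indep (I ∪ ⁅ x ⁆))

    HasRank : Subset n → ℕ → Set
    HasRank A k = Σ (Subset n) λ I → IsBasisOf A I × ∣ I ∣ ≡ k

    InClosure : Subset n → Fin n → Set
    InClosure A x = Σ ℕ λ k → HasRank A k × HasRank (A ∪ ⁅ x ⁆) k

    Spans : Subset n → Subset n → Set
    Spans A H = ∀ x → (x ∈ H) iff (InClosure A x)

    IsFlat : Subset n → Set
    IsFlat F = ∀ x → x ∉ F → ¬ InClosure F x

    IsHyperplane : Subset n → Set
    IsHyperplane H = IsFlat H × Σ ℕ λ k → HasRank H k × HasRank full (suc k)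

    HasCorank2 : Subset n → Set
    HasCorank2 A = Σ ℕ λ k → HasRank A k × HasRank full (suc (suc k))

memb : ∀ {n} → Fin n → List (Fin n) → Bool
memb x [] = false
memb x (y ∷ ys) = if ⌊ x ≟ y ⌋ then true else memb x ys

distinct : ∀ {n} → List (Fin n) → Bool
distinct [] = true
distinct (x ∷ xs) = not (memb x xs) ∧ distinct xs

inversions : ∀ {n} → List (Fin n) → ℕ
inversions [] = 0
inversions (x ∷ xs) = length (filter (λ y → toℕ y N.<? toℕ x) xs) + inversions xs

isEven : ℕ → Bool
isEven zero = true
isEven (suc k) = not (isEven k)

module _ (𝕋 : Tract) where
  open Tract 𝕋

  sign : ∀ {n} → List (Fin n) → Carrier
  sign xs = if isEven (inversions xs) then 𝟙 else neg 𝟙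

  module _ {n : ℕ} where

    elems : List (Fin n)
    elems = L.allFin n

    _⊥_ : (Fin n → Carrier) → (Fin n → Carrier) → Set
    X ⊥ Y = N (map (λ e → X e · Y e) elems)

    LinDep3 : (Fin n → Carrier) → (Fin n → Carrier) → (Fin n → Carrier) → Set
    LinDep3 X₁ X₂ X₃ = Σ Carrier λ c₁ → Σ Carrier λ c₂ → Σ Carrier λ c₃ →
      ¬ (c₁ ≡ 𝟘 × c₂ ≡ 𝟘 × c₃ ≡ 𝟘) ×
      (∀ e → N (c₁ · X₁ e ∷ c₂ · X₂ e ∷ c₃ · X₃ e ∷ []))

    Bases : ∀ {r} → (Vec (Fin n) r → Carrier) → Subset n → Set
    Bases {r} φ S = Σ (Vec (Fin n) r) λ e → φ e ≢ 𝟘 × vset e ≡ S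

    GP1 : ∀ {r} → (Vec (Fin n) r → Carrier) → Set
    GP1 φ = Σ (Subset n) (Bases φ) × IsMatroid (Bases φ)

    GP2 : ∀ {r} → (Vec (Fin n) r → Carrier) → Set
    GP2 {r} φ =
      (∀ (x : Vec (Fin n) r) (i j : Fin r) → i ≢ j →
         φ ((x [ i ]≔ lookup x j) [ j ]≔ lookup x i) ≡ neg (φ x)) ×
      (∀ (x : Vec (Fin n) r) (i j : Fin r) → i ≢ j → lookup x i ≡ lookup x j → φ x ≡ 𝟘)

    GP3 : ∀ {r} → (Vec (Fin n) r → Carrier) → Set
    GP3 {zero} φ = ⊤
    GP3 {suc zero} φ = ⊤
    GP3 {suc (suc k)} φ = ∀ (u : Vec (Fin n) k) (a b c d : Fin n) →
      N ( φ' u a b · φ' u c d ∷ neg (φ' u a c · φ' u b d) ∷ φ' u a d · φ' u b c ∷ [])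
      where φ' : Vec (Fin n) k → Fin n → Fin n → Carrier
            φ' u x y = φ ((u ∷ʳ x) ∷ʳ y)

    IsGP : ∀ {r} → (Vec (Fin n) r → Carrier) → Set
    IsGP φ = GP1 φ × GP2 φ × GP3 φ

    VectorSet : ∀ {r} → (Vec (Fin n) r → Carrier) → (Fin n → Carrier) → Set
    VectorSet {zero} φ X = ⊤
    VectorSet {suc k} φ X = ∀ (i : Vec (Fin n) k) → N (map (λ e → X e · φ (i ∷ʳ e)) elems)

    -- dual GP function φ* (E = Fin n totally ordered as usual)
    -- the elements of E not occurring in d, in increasing order
    complement : List (Fin n) → List (Fin n)
    complement d = filter (λ x → ¬? (memb x d B.≟ true)) elems

    dual : ∀ {r} → (Vec (Fin n) r → Carrier) → Vec (Fin n) (n N.∸ r) → Carrier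
    dual {r} φ d with distinct (toList d) | length (complement (toList d)) N.≟ r
    ... | false | _ = 𝟘
    ... | true | no _ = 𝟘
    ... | true | yes p = sign (toList d ++ complement (toList d)) ·
                         φ (subst (Vec (Fin n)) p (fromList (complement (toList d))))

    IsHyperplaneFunction : Subset n → (Fin n → Carrier) → Set
    IsHyperplaneFunction H X = ∀ e → (X e ≢ 𝟘) iff (e ∉ H)

    IsRepresentation : (Subset n → Set) → (Subset n → Fin n → Carrier) → Set
    IsRepresentation M η =
      (∀ H → IsHyperplane M H → IsHyperplaneFunction H (η H)) ×
      (∀ H₁ H₂ H₃ → IsHyperplane M H₁ → IsHyperplane M H₂ → IsHyperplane M H₃ →
         H₁ ≢ H₂ → H₁ ≢ H₃ → H₂ ≢ H₃ → HasCorank2 M ((H₁ ∩ H₂) ∩ H₃) →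
         LinDep3 (η H₁) (η H₂) (η H₃))

    Corresponds : ∀ {r} → (Vec (Fin n) r → Carrier) → (Subset n → Fin n → Carrier) → Set
    Corresponds {zero} φ η = ⊤
    Corresponds {suc k} φ η =
      ∀ H → IsHyperplane (Bases φ) H →
      ∀ (i : Vec (Fin n) k) → (∀ j → lookup i j ∈ H) → Spans (Bases φ) (vset i) H →
      ∀ d e → d ∉ H → e ∉ H →
      η H d · inv (η H e) ≡ φ (i ∷ʳ d) · inv (φ (i ∷ʳ e))

    -- F-quotient φ_F for an ordered basis i of F, with k + s = r
    quotientGP : ∀ {r k s} → (Vec (Fin n) r → Carrier) → k + s ≡ r →
                 Vec (Fin n) k → Vec (Fin n) s → Carrier
    quotientGP φ eq i e = φ (subst (Vec (Fin n)) eq (i V.++ e))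

  Perfect : Set
  Perfect = ∀ {n r} (φ : Vec (Fin n) r → Carrier) → IsGP φ →
    ∀ X Y → VectorSet φ X → VectorSet (dual φ) Y → X ⊥ Y

-- Let I be the set of entries of the basis i of F and M/I the matroid of the F-quotient φ(i, ·).
-- Since φ is alternating, a nonzero value of φ survives any rearrangement of its arguments, so a set J
-- is independent in M/I exactly when J avoids I and I ∪ J is independent in M. As all bases of a set
-- have the same size (by basis exchange), ranks in M/I are ranks in M shifted by |I| and closures agree
-- outside I. Hence every hyperplane of M/I is a hyperplane of M containing I, corank-2 sets transfer in
-- the same way, and a tuple w spanning such a hyperplane in M/I yields the spanning tuple (i, w) in M,
-- at which φ(i, w, d) is the quotient's value at (w, d). Both conditions on η thus restrict to M/I.

module Submission where

open import Defs
open import Data.Nat using (ℕ; zero; suc; _+_; _≤_; _<_; s≤s)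
open import Data.Nat.Properties
  using ( +-suc; ≤-trans; ≤-reflexive; ≤-antisym; ≤-<-trans; <-irrefl; 1+n≰n; n≤1+n; suc-injective
        ; +-monoʳ-≤; +-cancelʳ-≤; module ≤-Reasoning)
open import Data.Fin using (Fin; zero; suc; _≟_)
import Data.Fin.Properties as Fin
open import Data.Fin.Subset using (Subset; _∈_; _∉_; _⊆_; _⊂_; _∪_; _∩_; _─_; _-_; ⁅_⁆; ∣_∣; inside; outside) renaming (⊥ to ∅)
open import Data.Fin.Subset.Properties
open import Data.Vec using (Vec; []; _∷_; here; there; lookup; _++_; _∷ʳ_; _[_]≔_)
open import Data.Vec.Properties using (lookup∘update; lookup∘update′)
open import Data.Product using (Σ-syntax; ∃; _×_; _,_; proj₁; proj₂)
open import Data.List using ([]; _∷_)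
import Data.List.Relation.Binary.Permutation.Propositional as Perm
open import Data.Sum using (inj₁; inj₂; [_,_])
open import Data.Empty using (⊥; ⊥-elim)
open import Data.Unit using (tt)
open import Function using (_∘_)
open import Function.Definitions using (Injective)
open import Relation.Nullary using (¬_; yes; no; ¬¬-excluded-middle)
open import Induction.WellFounded using (Acc; acc)
open import Data.Nat.Induction using (<-wellFounded)
open import Relation.Binary.PropositionalEquality using (_≡_; _≢_; refl; sym; trans; cong; subst; subst₂)

private
  variable
    n m l : ℕ
    A : Set

Disjoint : Subset n → Subset n → Set
Disjoint p q = ∀ {x} → x ∈ p → x ∉ q

x∈p─q⇒x∉q : ∀ {x : Fin n} (p q : Subset n) → x ∈ p ─ q → x ∉ q
x∈p─q⇒x∉q (inside ∷ p) (outside ∷ q) here ()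
x∈p─q⇒x∉q (_ ∷ p) (_ ∷ q) (there x∈p─q) (there x∈q) = x∈p─q⇒x∉q p q x∈p─q x∈q

∣p∣≡∣p∩q∣+∣p─q∣ : ∀ (p q : Subset n) → ∣ p ∣ ≡ ∣ p ∩ q ∣ + ∣ p ─ q ∣
∣p∣≡∣p∩q∣+∣p─q∣ [] [] = refl
∣p∣≡∣p∩q∣+∣p─q∣ (inside ∷ p) (inside ∷ q) = cong suc (∣p∣≡∣p∩q∣+∣p─q∣ p q)
∣p∣≡∣p∩q∣+∣p─q∣ (inside ∷ p) (outside ∷ q) = trans (cong suc (∣p∣≡∣p∩q∣+∣p─q∣ p q)) (sym (+-suc _ _))
∣p∣≡∣p∩q∣+∣p─q∣ (outside ∷ p) (inside ∷ q) = ∣p∣≡∣p∩q∣+∣p─q∣ p q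
∣p∣≡∣p∩q∣+∣p─q∣ (outside ∷ p) (outside ∷ q) = ∣p∣≡∣p∩q∣+∣p─q∣ p q

disjoint⇒∣p∪q∣≡∣p∣+∣q∣ : ∀ (p q : Subset n) → Disjoint p q → ∣ p ∪ q ∣ ≡ ∣ p ∣ + ∣ q ∣
disjoint⇒∣p∪q∣≡∣p∣+∣q∣ [] [] _ = refl
disjoint⇒∣p∪q∣≡∣p∣+∣q∣ (inside ∷ p) (inside ∷ q) disj = ⊥-elim (disj here here)
disjoint⇒∣p∪q∣≡∣p∣+∣q∣ (inside ∷ p) (outside ∷ q) disj =
  cong suc (disjoint⇒∣p∪q∣≡∣p∣+∣q∣ p q (λ x∈p x∈q → disj (there x∈p) (there x∈q)))
disjoint⇒∣p∪q∣≡∣p∣+∣q∣ (outside ∷ p) (inside ∷ q) disj =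
  trans (cong suc (disjoint⇒∣p∪q∣≡∣p∣+∣q∣ p q (λ x∈p x∈q → disj (there x∈p) (there x∈q)))) (sym (+-suc _ _))
disjoint⇒∣p∪q∣≡∣p∣+∣q∣ (outside ∷ p) (outside ∷ q) disj =
  disjoint⇒∣p∪q∣≡∣p∣+∣q∣ p q (λ x∈p x∈q → disj (there x∈p) (there x∈q))

x∈p⇒⁅x⁆⊆p : ∀ {x : Fin n} {p} → x ∈ p → ⁅ x ⁆ ⊆ p
x∈p⇒⁅x⁆⊆p {x = x} {p} x∈p y∈⁅x⁆ = subst (_∈ p) (sym (x∈⁅y⁆⇒x≡y x y∈⁅x⁆)) x∈p

∪-least : ∀ {p q r : Subset n} → p ⊆ r → q ⊆ r → p ∪ q ⊆ r
∪-least {p = p} {q} p⊆r q⊆r = [ p⊆r , q⊆r ] ∘ x∈p∪q⁻ p q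

p⊆q⇒p∪q≡q : ∀ {p q : Subset n} → p ⊆ q → p ∪ q ≡ q
p⊆q⇒p∪q≡q {q = q} p⊆q = ⊆-antisym (∪-least p⊆q ⊆-refl) (q⊆p∪q _ q)

disjoint-⊆-∪⇒⊆ : ∀ {p q r : Subset n} → Disjoint p q → p ⊆ q ∪ r → p ⊆ r
disjoint-⊆-∪⇒⊆ {q = q} {r} p-avoids-q p⊆q∪r x∈p with x∈p∪q⁻ q r (p⊆q∪r x∈p)
... | inj₁ x∈q = ⊥-elim (p-avoids-q x∈p x∈q)
... | inj₂ x∈r = x∈r

p─q⊆r⇒p─r⊆q─r : ∀ {p q r : Subset n} → p ─ q ⊆ r → p ─ r ⊆ q ─ r
p─q⊆r⇒p─r⊆q─r {p = p} {q} {r} p─q⊆r {x} x∈p─r with x ∈? q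
... | yes x∈q = x∈p∧x∉q⇒x∈p─q x∈q (x∈p─q⇒x∉q p r x∈p─r)
... | no x∉q = ⊥-elim (x∈p─q⇒x∉q p r x∈p─r (p─q⊆r (x∈p∧x∉q⇒x∈p─q (p─q⊆p p r x∈p─r) x∉q)))

y∈q⇒[p-x]∪⁅y⁆─q⊆[p─q]-x : ∀ {x y : Fin n} {p q} → y ∈ q → ((p - x) ∪ ⁅ y ⁆) ─ q ⊆ (p ─ q) - x
y∈q⇒[p-x]∪⁅y⁆─q⊆[p─q]-x {x = x} {y} {p} {q} y∈q z∈ with x∈p∪q⁻ (p - x) ⁅ y ⁆ (p─q⊆p _ q z∈)
... | inj₁ z∈p-x = x∈p∧x∉q⇒x∈p─q (x∈p∧x∉q⇒x∈p─q (p─q⊆p p ⁅ x ⁆ z∈p-x) (x∈p─q⇒x∉q _ q z∈))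
                                 (x∈p─q⇒x∉q p ⁅ x ⁆ z∈p-x)
... | inj₂ z∈⁅y⁆ = ⊥-elim (x∈p─q⇒x∉q _ q z∈ (subst (_∈ q) (sym (x∈⁅y⁆⇒x≡y y z∈⁅y⁆)) y∈q))

∪-mono-⊆ : ∀ {p q r s : Subset n} → p ⊆ q → r ⊆ s → p ∪ r ⊆ q ∪ s
∪-mono-⊆ {p = p} {q} {r} {s} p⊆q r⊆s x∈p∪r with x∈p∪q⁻ p r x∈p∪r
... | inj₁ x∈p = p⊆p∪q s (p⊆q x∈p)
... | inj₂ x∈r = q⊆p∪q q s (r⊆s x∈r)

lookup∈vset : (v : Vec (Fin n) m) (t : Fin m) → lookup v t ∈ vset v
lookup∈vset (x ∷ v) zero = p⊆p∪q (vset v) (x∈⁅x⁆ x)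
lookup∈vset (x ∷ v) (suc t) = q⊆p∪q ⁅ x ⁆ (vset v) (lookup∈vset v t)

∈vset⇒lookup : ∀ {x} (v : Vec (Fin n) m) → x ∈ vset v → ∃ λ t → lookup v t ≡ x
∈vset⇒lookup [] x∈∅ = ⊥-elim (∉⊥ x∈∅)
∈vset⇒lookup (y ∷ v) x∈y∷v with x∈p∪q⁻ ⁅ y ⁆ (vset v) x∈y∷v
... | inj₁ x∈⁅y⁆ = zero , sym (x∈⁅y⁆⇒x≡y y x∈⁅y⁆)
... | inj₂ x∈v with ∈vset⇒lookup v x∈v
...   | t , eq = suc t , eq

lookup∈⇒vset⊆ : ∀ {S} (v : Vec (Fin n) m) → (∀ t → lookup v t ∈ S) → vset v ⊆ S
lookup∈⇒vset⊆ v v∈S x∈v with ∈vset⇒lookup v x∈v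
... | t , refl = v∈S t

vset-++ : (v : Vec (Fin n) m) (w : Vec (Fin n) l) → vset (v ++ w) ≡ vset v ∪ vset w
vset-++ [] w = sym (∪-identityˡ (vset w))
vset-++ (x ∷ v) w = trans (cong (⁅ x ⁆ ∪_) (vset-++ v w)) (sym (∪-assoc ⁅ x ⁆ (vset v) (vset w)))

Distinct : Vec (Fin n) m → Set
Distinct v = Injective _≡_ _≡_ (lookup v)

∷-distinct : ∀ {x} {v : Vec (Fin n) m} → x ∉ vset v → Distinct v → Distinct (x ∷ v)
∷-distinct         x∉v dist {zero}  {zero}  _  = refl
∷-distinct {v = v} x∉v dist {zero}  {suc q} eq = ⊥-elim (x∉v (subst (_∈ vset v) (sym eq) (lookup∈vset v q)))
∷-distinct {v = v} x∉v dist {suc p} {zero}  eq = ⊥-elim (x∉v (subst (_∈ vset v) eq (lookup∈vset v p)))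
∷-distinct         x∉v dist {suc p} {suc q} eq = cong suc (dist eq)

distinct-head : ∀ {x} (v : Vec (Fin n) m) → Distinct (x ∷ v) → x ∉ vset v
distinct-head v dist x∈v with ∈vset⇒lookup v x∈v
... | t , eq with dist {zero} {suc t} (sym eq)
...   | ()

distinct-tail : ∀ {x} {v : Vec (Fin n) m} → Distinct (x ∷ v) → Distinct v
distinct-tail dist = Fin.suc-injective ∘ dist

∣⁅x⁆∪p∣≡1+∣p∣ : ∀ (x : Fin n) p → x ∉ p → ∣ ⁅ x ⁆ ∪ p ∣ ≡ suc ∣ p ∣
∣⁅x⁆∪p∣≡1+∣p∣ x p x∉p =
  trans (disjoint⇒∣p∪q∣≡∣p∣+∣q∣ ⁅ x ⁆ p (λ y∈⁅x⁆ → subst (_∉ p) (sym (x∈⁅y⁆⇒x≡y x y∈⁅x⁆)) x∉p))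
        (cong (_+ ∣ p ∣) (∣⁅x⁆∣≡1 x))

∣vset∣≤length : (v : Vec (Fin n) m) → ∣ vset v ∣ ≤ m
∣vset∣≤length {n = n} [] = ≤-reflexive (∣⊥∣≡0 n)
∣vset∣≤length (x ∷ v) with x ∈? vset v
... | yes x∈v = ≤-trans (≤-reflexive (cong ∣_∣ (p⊆q⇒p∪q≡q (x∈p⇒⁅x⁆⊆p x∈v)))) (≤-trans (∣vset∣≤length v) (n≤1+n _))
... | no x∉v = ≤-trans (≤-reflexive (∣⁅x⁆∪p∣≡1+∣p∣ x (vset v) x∉v)) (s≤s (∣vset∣≤length v))

Distinct⇒∣vset∣≡length : (v : Vec (Fin n) m) → Distinct v → ∣ vset v ∣ ≡ m
Distinct⇒∣vset∣≡length {n = n} [] _ = ∣⊥∣≡0 n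
Distinct⇒∣vset∣≡length (x ∷ v) dist =
  trans (∣⁅x⁆∪p∣≡1+∣p∣ x (vset v) (distinct-head v dist)) (cong suc (Distinct⇒∣vset∣≡length v (distinct-tail dist)))

∣vset∣≡length⇒Distinct : (v : Vec (Fin n) m) → ∣ vset v ∣ ≡ m → Distinct v
∣vset∣≡length⇒Distinct [] _ {()}
∣vset∣≡length⇒Distinct {m = suc m} (x ∷ v) ∣x∷v∣≡1+m with x ∈? vset v
... | yes x∈v = ⊥-elim (1+n≰n (≤-trans (≤-reflexive (trans (sym ∣x∷v∣≡1+m) (cong ∣_∣ (p⊆q⇒p∪q≡q (x∈p⇒⁅x⁆⊆p x∈v)))))
                                      (∣vset∣≤length v)))
... | no x∉v = ∷-distinct x∉v (∣vset∣≡length⇒Distinct v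
                  (suc-injective (trans (sym (∣⁅x⁆∪p∣≡1+∣p∣ x (vset v) x∉v)) ∣x∷v∣≡1+m)))

distinct-++⇒disjoint : (v : Vec (Fin n) m) (w : Vec (Fin n) l) → Distinct (v ++ w) → Disjoint (vset v) (vset w)
distinct-++⇒disjoint [] w dist y∈∅ _ = ∉⊥ y∈∅
distinct-++⇒disjoint (x ∷ v) w dist {y} y∈x∷v y∈w with x∈p∪q⁻ ⁅ x ⁆ (vset v) y∈x∷v
... | inj₁ y∈⁅x⁆ rewrite x∈⁅y⁆⇒x≡y x y∈⁅x⁆ =
  distinct-head (v ++ w) dist (subst (x ∈_) (sym (vset-++ v w)) (q⊆p∪q (vset v) (vset w) y∈w))
... | inj₂ y∈v = distinct-++⇒disjoint v w (distinct-tail dist) y∈v y∈w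

swap : Vec (Fin n) m → Fin m → Fin m → Vec (Fin n) m
swap v p q = (v [ p ]≔ lookup v q) [ q ]≔ lookup v p

SwapInvariant : (Vec (Fin n) m → Set) → Set
SwapInvariant {m = m} P = ∀ v (p q : Fin m) → p ≢ q → P v → P (swap v p q)

vset⊆vset-update : ∀ (v : Vec (Fin n) m) t x → vset v ⊆ ⁅ lookup v t ⁆ ∪ vset (v [ t ]≔ x)
vset⊆vset-update v t x y∈v with ∈vset⇒lookup v y∈v
... | u , refl with u ≟ t
...   | yes refl = p⊆p∪q _ (x∈⁅x⁆ (lookup v u))
...   | no u≢t = q⊆p∪q _ _ (subst (_∈ vset (v [ t ]≔ x)) (lookup∘update′ u≢t v x) (lookup∈vset (v [ t ]≔ x) u))

moveToFront : ∀ {P : Vec (Fin n) (suc l) → Set} → SwapInvariant P → ∀ v t → P v →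
              Σ[ v′ ∈ Vec (Fin n) l ] P (lookup v t ∷ v′) × vset v ⊆ vset (lookup v t ∷ v′)
moveToFront inv (x ∷ v) zero Pv = v , Pv , ⊆-refl
moveToFront inv (x ∷ v) (suc t) Pv = v [ t ]≔ x , inv (x ∷ v) zero (suc t) (λ ()) Pv , x∷v⊆
  where
  x∷v⊆ : vset (x ∷ v) ⊆ ⁅ lookup v t ⁆ ∪ vset (v [ t ]≔ x)
  x∷v⊆ y∈x∷v with x∈p∪q⁻ ⁅ x ⁆ (vset v) y∈x∷v
  ... | inj₁ y∈⁅x⁆ = q⊆p∪q _ _ (subst (_∈ vset (v [ t ]≔ x)) (trans (lookup∘update t v x) (sym (x∈⁅y⁆⇒x≡y x y∈⁅x⁆)))
                                      (lookup∈vset (v [ t ]≔ x) t))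
  ... | inj₂ y∈v = vset⊆vset-update v t x y∈v

rearrange : ∀ {P : Vec (Fin n) (m + l) → Set} → SwapInvariant P → (w : Vec (Fin n) m) → Distinct w →
            ∀ v → P v → vset w ⊆ vset v → Σ[ u ∈ Vec (Fin n) l ] P (w ++ u) × vset v ⊆ vset (w ++ u)
rearrange inv [] _ v Pv _ = v , Pv , ⊆-refl
rearrange inv (x ∷ w) dist v Pv x∷w⊆v with ∈vset⇒lookup v (x∷w⊆v (lookup∈vset (x ∷ w) zero))
... | t , refl =
  let v′ , Pv′ , v⊆x∷v′ = moveToFront inv v t Pv
      w⊆v′ = disjoint-⊆-∪⇒⊆ (λ y∈w y∈⁅x⁆ → distinct-head w dist (subst (_∈ vset w) (x∈⁅y⁆⇒x≡y _ y∈⁅x⁆) y∈w))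
                            (v⊆x∷v′ ∘ x∷w⊆v ∘ q⊆p∪q _ _)
      u , Pxwu , v′⊆wu = rearrange (λ u p q p≢q → inv (_ ∷ u) (suc p) (suc q) (p≢q ∘ Fin.suc-injective))
                                   w (distinct-tail dist) v′ Pv′ w⊆v′
  in u , Pxwu , ∪-mono-⊆ ⊆-refl v′⊆wu ∘ v⊆x∷v′

module _ {n : ℕ} (B : Subset n → Set) where

  basis-extension : ∀ {A I} → Indep B I → I ⊆ A → ¬ ¬ (Σ[ J ∈ Subset n ] IsBasisOf B A J × I ⊆ J)
  basis-extension {A} {I} = extend (<-wellFounded ∣ A ─ I ∣)
    where
    extend : ∀ {I} → Acc _<_ ∣ A ─ I ∣ → Indep B I → I ⊆ A → ¬ ¬ (Σ[ J ∈ Subset n ] IsBasisOf B A J × I ⊆ J)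
    extend {I} (acc rec) indI I⊆A noBasis =
      ¬¬-excluded-middle {A = Σ[ x ∈ Fin n ] x ∈ A × x ∉ I × Indep B (I ∪ ⁅ x ⁆)} λ where
        (yes (x , x∈A , x∉I , indI∪x)) →
          extend (rec (subst (_< ∣ A ─ I ∣) (cong ∣_∣ (p─q─r≡p─q∪r A I ⁅ x ⁆))
                             (x∈p⇒∣p-x∣<∣p∣ (x∈p∧x∉q⇒x∈p─q x∈A x∉I))))
                 indI∪x
                 (∪-least I⊆A (x∈p⇒⁅x⁆⊆p x∈A))
                 (λ (J , basisJ , I∪x⊆J) → noBasis (J , basisJ , I∪x⊆J ∘ p⊆p∪q ⁅ x ⁆))
        (no noAugmentation) →
          noBasis (I , (I⊆A , indI , λ x x∈A x∉I indI∪x → noAugmentation (x , x∈A , x∉I , indI∪x)) , ⊆-refl)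

  dependent⇒InClosure : ∀ {A U x} → IsBasisOf B A U → ¬ Indep B (U ∪ ⁅ x ⁆) → InClosure B A x
  dependent⇒InClosure {A} {U} {x} basisU@(U⊆A , indU , maximal) dependent =
    ∣ U ∣ , (U , basisU , refl) , (U , (p⊆p∪q ⁅ x ⁆ ∘ U⊆A , indU , maximal′) , refl)
    where
    maximal′ : ∀ y → y ∈ A ∪ ⁅ x ⁆ → y ∉ U → ¬ Indep B (U ∪ ⁅ y ⁆)
    maximal′ y y∈A∪x y∉U with x∈p∪q⁻ A ⁅ x ⁆ y∈A∪x
    ... | inj₁ y∈A = maximal y y∈A y∉U
    ... | inj₂ y∈⁅x⁆ = subst (λ z → ¬ Indep B (U ∪ ⁅ z ⁆)) (sym (x∈⁅y⁆⇒x≡y x y∈⁅x⁆)) dependent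

  basis-∩ : ∀ {A J C} → IsBasisOf B A J → B C → J ⊆ C → C ∩ A ≡ J
  basis-∩ {A} {J} {C} (J⊆A , _ , maximal) bC J⊆C = ⊆-antisym C∩A⊆J (λ x∈J → x∈p∩q⁺ (J⊆C x∈J , J⊆A x∈J))
    where
    C∩A⊆J : C ∩ A ⊆ J
    C∩A⊆J {x} x∈C∩A with x ∈? J
    ... | yes x∈J = x∈J
    ... | no x∉J = ⊥-elim (maximal x (p∩q⊆q C A x∈C∩A) x∉J
                    (C , bC , ∪-least J⊆C (x∈p⇒⁅x⁆⊆p (p∩q⊆p C A x∈C∩A))))

module _ {n r : ℕ} {B : Subset n → Set} (matroid : IsMatroid B) (size : ∀ {S} → B S → ∣ S ∣ ≡ r) where

  -- Exchange the elements of B₁ ─ B₂ outside A one at a time; this never removes an element of J ⊆ A.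
  equalize : ∀ {A J B₁ B₂} → J ⊆ A → B B₁ → B B₂ → J ⊆ B₁ →
             Σ[ B₁′ ∈ Subset n ] B B₁′ × J ⊆ B₁′ × B₁′ ─ B₂ ⊆ A
  equalize {A} {J} {B₁} {B₂} J⊆A b₁ b₂ = go (<-wellFounded ∣ B₁ ─ B₂ ∣) b₁
    where
    go : ∀ {B₁} → Acc _<_ ∣ B₁ ─ B₂ ∣ → B B₁ → J ⊆ B₁ → Σ[ B₁′ ∈ Subset n ] B B₁′ × J ⊆ B₁′ × B₁′ ─ B₂ ⊆ A
    go {B₁} (acc rec) b₁ J⊆B₁ with nonempty? ((B₁ ─ B₂) ─ A)
    ... | no none = B₁ , b₁ , J⊆B₁ , B₁─B₂⊆A
      where
      B₁─B₂⊆A : B₁ ─ B₂ ⊆ A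
      B₁─B₂⊆A {x} x∈B₁─B₂ with x ∈? A
      ... | yes x∈A = x∈A
      ... | no x∉A = ⊥-elim (none (x , x∈p∧x∉q⇒x∈p─q x∈B₁─B₂ x∉A))
    ... | yes (x , x∈) =
      let x∈B₁─B₂ = p─q⊆p _ A x∈
          x∉A = x∈p─q⇒x∉q _ A x∈
          y , y∈B₂ , _ , b₁′ = proj₂ matroid B₁ B₂ b₁ b₂ x (p─q⊆p B₁ B₂ x∈B₁─B₂) (x∈p─q⇒x∉q B₁ B₂ x∈B₁─B₂)
      in go (rec (≤-<-trans (p⊆q⇒∣p∣≤∣q∣ (y∈q⇒[p-x]∪⁅y⁆─q⊆[p─q]-x {x = x} {p = B₁} y∈B₂))
                            (x∈p⇒∣p-x∣<∣p∣ x∈B₁─B₂)))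
            b₁′
            (λ z∈J → p⊆p∪q ⁅ y ⁆ (x∈p∧x≢y⇒x∈p-y (J⊆B₁ z∈J) (λ z≡x → x∉A (subst (_∈ A) z≡x (J⊆A z∈J)))))

  ∣basis∣≤∣basis∣ : ∀ {A J₁ J₂} → IsBasisOf B A J₁ → IsBasisOf B A J₂ → ∣ J₂ ∣ ≤ ∣ J₁ ∣
  ∣basis∣≤∣basis∣ {A} {J₁} {J₂} basis₁@(J₁⊆A , (C₁ , b₁ , J₁⊆C₁) , _) basis₂@(_ , (C₂ , b₂ , J₂⊆C₂) , _) =
    let D , bD , J₁⊆D , D─C₂⊆A = equalize J₁⊆A b₁ b₂ J₁⊆C₁
    in +-cancelʳ-≤ (∣ C₂ ─ A ∣) (∣ J₂ ∣) (∣ J₁ ∣) (begin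
      ∣ J₂ ∣ + ∣ C₂ ─ A ∣     ≡⟨ cong (λ X → ∣ X ∣ + ∣ C₂ ─ A ∣) (basis-∩ B basis₂ b₂ J₂⊆C₂) ⟨
      ∣ C₂ ∩ A ∣ + ∣ C₂ ─ A ∣ ≡⟨ ∣p∣≡∣p∩q∣+∣p─q∣ C₂ A ⟨
      ∣ C₂ ∣                  ≡⟨ trans (size b₂) (sym (size bD)) ⟩
      ∣ D ∣                   ≡⟨ ∣p∣≡∣p∩q∣+∣p─q∣ D A ⟩
      ∣ D ∩ A ∣ + ∣ D ─ A ∣   ≡⟨ cong (λ X → ∣ X ∣ + ∣ D ─ A ∣) (basis-∩ B basis₁ bD J₁⊆D) ⟩
      ∣ J₁ ∣ + ∣ D ─ A ∣      ≤⟨ +-monoʳ-≤ (∣ J₁ ∣) (p⊆q⇒∣p∣≤∣q∣ (p─q⊆r⇒p─r⊆q─r D─C₂⊆A)) ⟩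
      ∣ J₁ ∣ + ∣ C₂ ─ A ∣     ∎)
    where open ≤-Reasoning

  ∣basis∣≡∣basis∣ : ∀ {A J₁ J₂} → IsBasisOf B A J₁ → IsBasisOf B A J₂ → ∣ J₁ ∣ ≡ ∣ J₂ ∣
  ∣basis∣≡∣basis∣ basis₁ basis₂ = ≤-antisym (∣basis∣≤∣basis∣ basis₂ basis₁) (∣basis∣≤∣basis∣ basis₁ basis₂)

module _ (𝕋 : Tract) where
  open Tract 𝕋

  neg≢𝟘 : ∀ {a} → a ≢ 𝟘 → neg a ≢ 𝟘
  neg≢𝟘 {a} a≢𝟘 neg-a≡𝟘 = a≢𝟘 (trans (neg-unique 𝟘 a 𝟘+a∈N) (sym (neg-unique 𝟘 𝟘 𝟘+𝟘∈N)))
    where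
    𝟘+a∈N : N (𝟘 ∷ a ∷ [])
    𝟘+a∈N = N-perm (Perm.swap a 𝟘 Perm.refl) (subst (λ b → N (a ∷ b ∷ [])) neg-a≡𝟘 (neg-N a))
    𝟘+𝟘∈N : N (𝟘 ∷ 𝟘 ∷ [])
    𝟘+𝟘∈N = N-𝟘⁺ _ (N-𝟘⁺ _ N-[])

module _ (𝕋 : Tract) {n r : ℕ} {φ : Vec (Fin n) r → Tract.Carrier 𝕋} (gp2 : GP2 𝕋 φ) where
  open Tract 𝕋 using (𝟘)

  nonzero-swapInvariant : SwapInvariant (λ v → φ v ≢ 𝟘)
  nonzero-swapInvariant v p q p≢q φv≢𝟘 φ[swap]≡𝟘 = neg≢𝟘 𝕋 φv≢𝟘 (trans (sym (proj₁ gp2 v p q p≢q)) φ[swap]≡𝟘)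

  nonzero⇒Distinct : ∀ {v} → φ v ≢ 𝟘 → Distinct v
  nonzero⇒Distinct {v} φv≢𝟘 {p} {q} eq with p ≟ q
  ... | yes p≡q = p≡q
  ... | no p≢q = ⊥-elim (φv≢𝟘 (proj₂ gp2 v p q p≢q eq))

  ∣base∣≡rank : ∀ {S} → Bases 𝕋 φ S → ∣ S ∣ ≡ r
  ∣base∣≡rank (v , φv≢𝟘 , refl) = Distinct⇒∣vset∣≡length v (nonzero⇒Distinct φv≢𝟘)

module Contraction (𝕋 : Tract) {n k s : ℕ} (φ : Vec (Fin n) (k + s) → Tract.Carrier 𝕋) (gp : IsGP 𝕋 φ)
                   (i : Vec (Fin n) k) (i-distinct : Distinct i) (i-indep : Indep (Bases 𝕋 φ) (vset i)) where

  M M/I : Subset n → Set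
  M = Bases 𝕋 φ
  M/I = Bases 𝕋 (quotientGP 𝕋 φ refl i)

  I : Subset n
  I = vset i

  private
    gp2 : GP2 𝕋 φ
    gp2 = proj₁ (proj₂ gp)

    ∣basis∣≡∣basis∣ᴹ : ∀ {A J₁ J₂} → IsBasisOf M A J₁ → IsBasisOf M A J₂ → ∣ J₁ ∣ ≡ ∣ J₂ ∣
    ∣basis∣≡∣basis∣ᴹ = ∣basis∣≡∣basis∣ (proj₂ (proj₁ gp)) (∣base∣≡rank 𝕋 gp2)

  loop : ∀ {x C} → x ∈ I → M/I C → x ∉ C
  loop x∈I (e , φ[i++e]≢𝟘 , refl) = distinct-++⇒disjoint i e (nonzero⇒Distinct 𝕋 gp2 φ[i++e]≢𝟘) x∈I

  indep-avoids : ∀ {J} → Indep M/I J → Disjoint J I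
  indep-avoids (_ , bC , J⊆C) x∈J x∈I = loop x∈I bC (J⊆C x∈J)

  indep⁺ : ∀ {J} → Indep M/I J → Indep M (I ∪ J)
  indep⁺ {J} (_ , (e , φ[i++e]≢𝟘 , refl) , J⊆e) =
    vset (i ++ e) , (i ++ e , φ[i++e]≢𝟘 , refl) , subst (λ X → I ∪ J ⊆ X) (sym (vset-++ i e)) (∪-mono-⊆ ⊆-refl J⊆e)

  indep⁻ : ∀ {J} → Indep M (I ∪ J) → Disjoint J I → Indep M/I J
  indep⁻ {J} (_ , (b , φb≢𝟘 , refl) , I∪J⊆b) J-avoids-I =
    let e , φ[i++e]≢𝟘 , b⊆i++e = rearrange (nonzero-swapInvariant 𝕋 gp2) i i-distinct b φb≢𝟘 (I∪J⊆b ∘ p⊆p∪q J)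
        J⊆I∪e = subst (λ X → J ⊆ X) (vset-++ i e) (b⊆i++e ∘ I∪J⊆b ∘ q⊆p∪q I J)
    in vset e , (e , φ[i++e]≢𝟘 , refl) , disjoint-⊆-∪⇒⊆ J-avoids-I J⊆I∪e

  basis⁺ : ∀ {X U} → IsBasisOf M/I X U → IsBasisOf M (I ∪ X) (I ∪ U)
  basis⁺ {X} {U} (U⊆X , indU , maximal) = ∪-mono-⊆ ⊆-refl U⊆X , indep⁺ indU , maximal′
    where
    maximal′ : ∀ y → y ∈ I ∪ X → y ∉ I ∪ U → ¬ Indep M ((I ∪ U) ∪ ⁅ y ⁆)
    maximal′ y y∈I∪X y∉I∪U indI∪U∪y with x∈p∪q⁻ I X y∈I∪X
    ... | inj₁ y∈I = y∉I∪U (p⊆p∪q U y∈I)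
    ... | inj₂ y∈X = maximal y y∈X (y∉I∪U ∘ q⊆p∪q I U)
                       (indep⁻ (subst (Indep M) (∪-assoc I U ⁅ y ⁆) indI∪U∪y) U∪y-avoids-I)
      where
      U∪y-avoids-I : Disjoint (U ∪ ⁅ y ⁆) I
      U∪y-avoids-I z∈U∪y with x∈p∪q⁻ U ⁅ y ⁆ z∈U∪y
      ... | inj₁ z∈U = indep-avoids indU z∈U
      ... | inj₂ z∈⁅y⁆ = λ z∈I → y∉I∪U (p⊆p∪q U (subst (_∈ I) (x∈⁅y⁆⇒x≡y y z∈⁅y⁆) z∈I))

  rank⁺ : ∀ {X j} → HasRank M/I X j → HasRank M (I ∪ X) (k + j)
  rank⁺ (U , basisU@(_ , indU , _) , refl) =
    I ∪ U , basis⁺ basisU ,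
    trans (disjoint⇒∣p∪q∣≡∣p∣+∣q∣ I U (λ x∈I x∈U → indep-avoids indU x∈U x∈I))
          (cong (_+ ∣ U ∣) (Distinct⇒∣vset∣≡length i i-distinct))

  closure⁺ : ∀ {X x} → InClosure M/I X x → InClosure M (I ∪ X) x
  closure⁺ {X} {x} (j , rankX , rankX∪x) =
    k + j , rank⁺ rankX , subst (λ A → HasRank M A (k + j)) (sym (∪-assoc I X ⁅ x ⁆)) (rank⁺ rankX∪x)

  ∅-indep : Indep M/I ∅
  ∅-indep = indep⁻ (subst (Indep M) (sym (∪-identityʳ I)) i-indep) (λ x∈∅ _ → ∉⊥ x∈∅)

  augmentable⇒¬InClosure : ∀ {X U x} → IsBasisOf M/I X U → Indep M/I (U ∪ ⁅ x ⁆) → x ∉ I ∪ X → ¬ InClosure M (I ∪ X) x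
  augmentable⇒¬InClosure {X} {U} {x} basisU@(U⊆X , _) indU∪x x∉I∪X (_ , (V , basisV , ∣V∣≡j) , (W , basisW , ∣W∣≡j)) =
    basis-extension M (indep⁺ indU∪x) I∪U∪x⊆I∪X∪x λ (W′ , basisW′ , I∪U∪x⊆W′) →
    <-irrefl refl (begin-strict
      ∣ I ∪ U ∣             <⟨ p⊂q⇒∣p∣<∣q∣ I∪U⊂I∪U∪x ⟩
      ∣ I ∪ (U ∪ ⁅ x ⁆) ∣   ≤⟨ p⊆q⇒∣p∣≤∣q∣ I∪U∪x⊆W′ ⟩
      ∣ W′ ∣                ≡⟨ ∣basis∣≡∣basis∣ᴹ basisW′ basisW ⟩
      ∣ W ∣                 ≡⟨ trans ∣W∣≡j (sym ∣V∣≡j) ⟩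
      ∣ V ∣                 ≡⟨ ∣basis∣≡∣basis∣ᴹ basisV (basis⁺ basisU) ⟩
      ∣ I ∪ U ∣             ∎)
    where
    open ≤-Reasoning
    I∪U∪x⊆I∪X∪x : I ∪ (U ∪ ⁅ x ⁆) ⊆ (I ∪ X) ∪ ⁅ x ⁆
    I∪U∪x⊆I∪X∪x = subst (λ A → I ∪ (U ∪ ⁅ x ⁆) ⊆ A) (sym (∪-assoc I X ⁅ x ⁆))
                        (∪-mono-⊆ ⊆-refl (∪-mono-⊆ U⊆X ⊆-refl))
    I∪U⊂I∪U∪x : I ∪ U ⊂ I ∪ (U ∪ ⁅ x ⁆)
    I∪U⊂I∪U∪x =
      ∪-mono-⊆ ⊆-refl (p⊆p∪q ⁅ x ⁆) , x , q⊆p∪q I _ (q⊆p∪q U _ (x∈⁅x⁆ x)) , x∉I∪X ∘ ∪-mono-⊆ ⊆-refl U⊆X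

  -- A basis of X in M/I exists only classically, hence the double negation.
  closure⁻ : ∀ {X x} → InClosure M (I ∪ X) x → x ∉ I ∪ X → ¬ ¬ InClosure M/I X x
  closure⁻ {X} {x} closure x∉I∪X ¬closure =
    basis-extension M/I ∅-indep ⊥⊆ λ (U , basisU , _) →
    ¬¬-excluded-middle {A = Indep M/I (U ∪ ⁅ x ⁆)} λ where
      (yes indU∪x) → augmentable⇒¬InClosure basisU indU∪x x∉I∪X closure
      (no dependent) → ¬closure (dependent⇒InClosure M/I basisU dependent)

  I⊆flat : ∀ {F j} → IsFlat M/I F → HasRank M/I F j → I ⊆ F
  I⊆flat {F} flat (U , basisU , _) {x} x∈I with x ∈? F
  ... | yes x∈F = x∈F
  ... | no x∉F = ⊥-elim (flat x x∉F (dependent⇒InClosure M/I basisU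
                   (λ indU∪x → indep-avoids indU∪x (q⊆p∪q U ⁅ x ⁆ (x∈⁅x⁆ x)) x∈I)))

  I⊆hyperplane : ∀ {H} → IsHyperplane M/I H → I ⊆ H
  I⊆hyperplane (flat , _ , rankH , _) = I⊆flat flat rankH

  hyperplane⁺ : ∀ {H} → IsHyperplane M/I H → IsHyperplane M H
  hyperplane⁺ {H} h@(flat , j , rankH , rankE) =
    flat⁺ , k + j , subst (λ A → HasRank M A (k + j)) I∪H≡H (rank⁺ rankH) ,
    subst₂ (HasRank M) (∪-zeroʳ I) (+-suc k j) (rank⁺ rankE)
    where
    I∪H≡H : I ∪ H ≡ H
    I∪H≡H = p⊆q⇒p∪q≡q (I⊆hyperplane h)
    flat⁺ : IsFlat M H
    flat⁺ x x∉H closure =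
      closure⁻ (subst (λ A → InClosure M A x) (sym I∪H≡H) closure) (x∉H ∘ subst (x ∈_) I∪H≡H) (flat x x∉H)

  corank2⁺ : ∀ {A} → I ⊆ A → HasCorank2 M/I A → HasCorank2 M A
  corank2⁺ I⊆A (j , rankA , rankE) =
    k + j , subst (λ X → HasRank M X (k + j)) (p⊆q⇒p∪q≡q I⊆A) (rank⁺ rankA) ,
    subst₂ (HasRank M) (∪-zeroʳ I) (trans (+-suc k (suc j)) (cong suc (+-suc k j))) (rank⁺ rankE)

  representation⁺ : ∀ {η} → IsRepresentation 𝕋 M η → IsRepresentation 𝕋 M/I η
  representation⁺ (hyperplaneFunction , dependent) =
    (λ H h → hyperplaneFunction H (hyperplane⁺ h)) ,
    λ H₁ H₂ H₃ h₁ h₂ h₃ H₁≢H₂ H₁≢H₃ H₂≢H₃ corank2 →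
      dependent H₁ H₂ H₃ (hyperplane⁺ h₁) (hyperplane⁺ h₂) (hyperplane⁺ h₃) H₁≢H₂ H₁≢H₃ H₂≢H₃
        (corank2⁺ (λ x∈I → x∈p∩q⁺ (x∈p∩q⁺ (I⊆hyperplane h₁ x∈I , I⊆hyperplane h₂ x∈I) , I⊆hyperplane h₃ x∈I))
                  corank2)

  spans⁺ : ∀ {H X} → IsHyperplane M/I H → X ⊆ H → Spans M/I X H → Spans M (I ∪ X) H
  spans⁺ {H} {X} h X⊆H spans x = closure⁺ ∘ proj₁ (spans x) , closure⇒∈H
    where
    closure⇒∈H : InClosure M (I ∪ X) x → x ∈ H
    closure⇒∈H closure with x ∈? H
    ... | yes x∈H = x∈H
    ... | no x∉H = ⊥-elim (closure⁻ closure (x∉H ∘ ∪-least (I⊆hyperplane h) X⊆H) (x∉H ∘ proj₂ (spans x)))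

-- u ++ w typed with length m + suc l: for φ of arity suc m + suc l = suc (m + suc l),
-- Corresponds quantifies over prefixes of exactly that length.
_++′_ : Vec A (suc m) → Vec A l → Vec A (m + suc l)
(x ∷ []) ++′ w = x ∷ w
(x ∷ y ∷ u) ++′ w = x ∷ ((y ∷ u) ++′ w)

++′-∷ʳ : ∀ (u : Vec A (suc m)) (w : Vec A l) d → (u ++′ w) ∷ʳ d ≡ u ++ (w ∷ʳ d)
++′-∷ʳ (x ∷ []) w d = refl
++′-∷ʳ (x ∷ y ∷ u) w d = cong (x ∷_) (++′-∷ʳ (y ∷ u) w d)

vset-++′ : ∀ (u : Vec (Fin n) (suc m)) (w : Vec (Fin n) l) → vset (u ++′ w) ≡ vset (u ++ w)
vset-++′ (x ∷ []) w = refl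
vset-++′ (x ∷ y ∷ u) w = cong (⁅ x ⁆ ∪_) (vset-++′ (y ∷ u) w)

corresponds-quotient : (𝕋 : Tract) {n k s : ℕ} (φ : Vec (Fin n) (k + s) → Tract.Carrier 𝕋) (gp : IsGP 𝕋 φ)
                       (i : Vec (Fin n) k) (i-distinct : Distinct i) (i-indep : Indep (Bases 𝕋 φ) (vset i)) →
                       ∀ {η} → Corresponds 𝕋 φ η → Corresponds 𝕋 (quotientGP 𝕋 φ refl i) η
corresponds-quotient 𝕋 {s = zero} _ _ _ _ _ _ = tt
corresponds-quotient 𝕋 {k = zero} {suc s} φ gp [] i-distinct i-indep correspondence H h w w⊆H spans =
  correspondence H (hyperplane⁺ h) w w⊆H
    (subst (λ X → Spans M X H) (∪-identityˡ (vset w)) (spans⁺ h (lookup∈⇒vset⊆ w w⊆H) spans))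
  where open Contraction 𝕋 φ gp [] i-distinct i-indep
corresponds-quotient 𝕋 {k = suc k} {suc s} φ gp i i-distinct i-indep {η} correspondence H h w w⊆H spans d e d∉H e∉H =
  subst₂ (λ u v → η H d · inv (η H e) ≡ φ u · inv (φ v)) (++′-∷ʳ i w d) (++′-∷ʳ i w e)
    (correspondence H (hyperplane⁺ h) (i ++′ w) (λ t → i++′w⊆H (lookup∈vset (i ++′ w) t)) spanning d e d∉H e∉H)
  where
  open Tract 𝕋
  open Contraction 𝕋 φ gp i i-distinct i-indep
  vset[i++′w]≡I∪w : vset (i ++′ w) ≡ I ∪ vset w
  vset[i++′w]≡I∪w = trans (vset-++′ i w) (vset-++ i w)
  i++′w⊆H : vset (i ++′ w) ⊆ H
  i++′w⊆H = subst (λ X → X ⊆ H) (sym vset[i++′w]≡I∪w) (∪-least (I⊆hyperplane h) (lookup∈⇒vset⊆ w w⊆H))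
  spanning : Spans M (vset (i ++′ w)) H
  spanning = subst (λ X → Spans M X H) (sym vset[i++′w]≡I∪w) (spans⁺ h (lookup∈⇒vset⊆ w w⊆H) spans)

proposition2p2 : (𝕋 : Tract) → Perfect 𝕋 →
    ∀ {n r : ℕ} (φ : Vec (Fin n) r → Tract.Carrier 𝕋) → IsGP 𝕋 φ →
    (F : Subset n) → IsFlat (Bases 𝕋 φ) F →
    (η : Subset n → Fin n → Tract.Carrier 𝕋) →
    IsRepresentation 𝕋 (Bases 𝕋 φ) η → Corresponds 𝕋 φ η →
    ∀ (k s : ℕ) (eq : k + s ≡ r) (i : Vec (Fin n) k) →
    ∣ vset i ∣ ≡ k → IsBasisOf (Bases 𝕋 φ) F (vset i) →
    IsRepresentation 𝕋 (Bases 𝕋 (quotientGP 𝕋 φ eq i)) η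
      × Corresponds 𝕋 (quotientGP 𝕋 φ eq i) η
proposition2p2 𝕋 _ φ gp F _ η representation correspondence k s refl i ∣i∣≡k (_ , i-indep , _) =
  representation⁺ representation , corresponds-quotient 𝕋 φ gp i i-distinct i-indep correspondence
  where
  i-distinct : Distinct i
  i-distinct = ∣vset∣≡length⇒Distinct i ∣i∣≡k
  open Contraction 𝕋 φ gp i i-distinct i-indep
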